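{- Let $f(x),g(x)\in\mathbb{Z}[x]$ be polynomials of positive degree having no common complex root, and let $d=\gcd(L(f),L(g))$. Then there exists a non-negative integer $k$ such that $B(f,g)\mid d^k\, r(f,g)$.
   Context: $L(h)$ denotes the leading coefficient of $h\in\mathbb{Z}[x]$. There are unique $p,q\in\mathbb{Q}[x]$ with $pf+qg=1$, $\deg p<\deg g$, $\deg q<\deg f$; $B(f,g)$ is the least common multiple of the denominators (in lowest terms) of all coefficients of these $p$ and $q$. $r(f,g)$ (the reduced resultant) is the smallest positive integer in the set $\{p(x)f(x)+q(x)g(x): p,q\in\mathbb{Z}[x]\}$. -}

module Defs where

open import Data.Nat as ℕ using (ℕ; zero; suc; _≤_; _<_)
open import Data.Nat.GCD using (gcd)
open import Data.Nat.LCM using (lcm)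
open import Data.Integer as ℤ using (ℤ; +_; ∣_∣)
open import Data.Rational as ℚ using (ℚ)
open import Data.List using (List; []; _∷_; map; foldr; _++_)
open import Data.Product using (Σ; ∃; _×_; _,_)
open import Relation.Binary.PropositionalEquality using (_≡_; _≢_)

-- Polynomials are represented by coefficient lists, constant term first.
-- Trailing zero coefficients are allowed; polynomial equality is
-- coefficientwise (see _≈P_), so the representation is irrelevant.
module PolyOps {A : Set} (0# : A) (_+_ _*_ : A → A → A) where

  addP : List A → List A → List A
  addP [] q = q
  addP (a ∷ p) [] = a ∷ p
  addP (a ∷ p) (b ∷ q) = (a + b) ∷ addP p q

  scaleP : A → List A → List A
  scaleP a = map (a *_)

  mulP : List A → List A → List A
  mulP [] q = []
  mulP (a ∷ p) q = addP (scaleP a q) (0# ∷ mulP p q)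

  coeff : List A → ℕ → A
  coeff [] n = 0#
  coeff (a ∷ p) zero = a
  coeff (a ∷ p) (suc n) = coeff p n

  _≈P_ : List A → List A → Set
  p ≈P q = ∀ n → coeff p n ≡ coeff q n

  HasDegree : List A → ℕ → Set
  HasDegree p n = (coeff p n ≢ 0#) × (∀ m → n < m → coeff p m ≡ 0#)

  -- deg p < n  (the zero polynomial has degree -∞, so satisfies this)
  DegLt : List A → ℕ → Set
  DegLt p n = ∀ m → n ≤ m → coeff p m ≡ 0#

module ZP = PolyOps (+ 0) ℤ._+_ ℤ._*_
module QP = PolyOps ℚ.0ℚ ℚ._+_ ℚ._*_

toℚ : ℤ → ℚ
toℚ z = z ℚ./ 1

toℚP : List ℤ → List ℚ
toℚP = map toℚ

-- f and g are coprime in ℚ[x]: some p, q ∈ ℚ[x] with p f + q g = 1.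
-- (For f, g ∈ ℤ[x] this is equivalent to having no common complex root.)
CoprimeQ : List ℤ → List ℤ → Set
CoprimeQ f g = ∃ λ p → ∃ λ q →
  QP._≈P_ (QP.addP (QP.mulP p (toℚP f)) (QP.mulP q (toℚP g))) (ℚ.1ℚ ∷ [])

IsBezoutPair : List ℤ → List ℤ → ℕ → ℕ → List ℚ → List ℚ → Set
IsBezoutPair f g m n p q =
  QP._≈P_ (QP.addP (QP.mulP p (toℚP f)) (QP.mulP q (toℚP g))) (ℚ.1ℚ ∷ [])
  × QP.DegLt p n × QP.DegLt q m

lcmDenoms : List ℚ → ℕ
lcmDenoms = foldr (λ c acc → lcm (ℚ.denominatorℕ c) acc) 1

B : List ℚ → List ℚ → ℕ
B p q = lcmDenoms (p ++ q)

InIdealZ : List ℤ → List ℤ → ℤ → Set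
InIdealZ f g c = ∃ λ p → ∃ λ q →
  ZP._≈P_ (ZP.addP (ZP.mulP p f) (ZP.mulP q g)) (c ∷ [])

IsReducedResultant : List ℤ → List ℤ → ℕ → Set
IsReducedResultant f g r =
  (0 < r) × InIdealZ f g (+ r) × (∀ s → 0 < s → InIdealZ f g (+ s) → r ≤ s)

gcdLead : List ℤ → List ℤ → ℕ → ℕ → ℕ
gcdLead f g m n = gcd ∣ ZP.coeff f m ∣ ∣ ZP.coeff g n ∣

{-# OPTIONS --safe #-}
module Submission where

-- Write r = P f + Q g with P, Q ∈ ℤ[x].  Pseudo-dividing P by g turns this into
-- L(g)^e r = R f + Q′ g with R, Q′ ∈ ℤ[x] and deg R < deg g.  Over ℚ the solution of
-- a f + b g = c with deg a < deg g is unique, so (R, Q′) = L(g)^e r · (p, q): every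
-- denominator of p and q divides L(g)^e r.  Symmetrically it divides L(f)^e′ r, and
-- therefore it divides d^(e + e′) r.  Only r ∈ (f, g)ℤ[x] is used, not its minimality.

open import Defs
open import Level using (0ℓ)
open import Data.List using (List; []; _∷_; map; length)
open import Data.Nat as ℕ using (ℕ; zero; suc; _≤_; _<_; s≤s; z≤n)
import Data.Nat.Properties as ℕP
open import Data.Nat.Divisibility using (_∣_; divides; ∣n⇒∣m*n; 1∣_)
import Data.Nat.Coprimality as Coprime
open import Data.Nat.GCD using (gcd; gcd-greatest; c*gcd[m,n]≡gcd[cm,cn])
open import Data.Nat.LCM using (lcm-least)
open import Data.Integer as ℤ using (ℤ; ∣_∣)
import Data.Integer.Properties as ℤP
open import Data.Rational as ℚ using (ℚ; mkℚ; toℚᵘ)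
import Data.Rational.Properties as ℚP
open import Data.Rational.Unnormalised as ℚᵘ using (mkℚᵘ; *≡*)
import Data.Rational.Unnormalised.Properties as ℚᵘP
open import Data.Product as Product using (∃; _×_; _,_; proj₁; proj₂)
open import Data.Sum using (inj₁; inj₂)
open import Algebra.Bundles using (CommutativeRing; Semiring)
open import Algebra.Structures using (IsCommutativeRing)
import Algebra.Definitions.RawSemiring as RawSemiringDefinitions
import Algebra.Properties.CommutativeSemigroup as CommutativeSemigroupProperties
import Algebra.Properties.Ring as RingProperties
import Algebra.Solver.Ring.NaturalCoefficients.Default as SemiringSolver
open import Relation.Binary.Bundles using (Setoid)
open import Relation.Binary.Structures using (IsEquivalence)
import Relation.Binary.Reasoning.Setoid as SetoidReasoning
open import Relation.Binary.PropositionalEquality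

module Polynomials {A : Set} {zero# one# : A} {add mul : A → A → A} {neg : A → A}
                   (isCommutativeRing : IsCommutativeRing _≡_ add mul neg zero# one#) where

  private
    R : CommutativeRing 0ℓ 0ℓ
    R = record { isCommutativeRing = isCommutativeRing }

  open CommutativeRing R using
    ( 0#; 1#; _+_; _*_; -_
    ; +-assoc; +-comm; +-identityˡ; +-identityʳ; -‿inverseˡ; -‿inverseʳ
    ; *-assoc; *-comm; *-identityˡ; zeroˡ; zeroʳ; distribˡ; +-commutativeSemigroup)

  open PolyOps 0# _+_ _*_ public

  open RingProperties (CommutativeRing.ring R) using (-0#≈0#)
  open RawSemiringDefinitions (Semiring.rawSemiring (CommutativeRing.semiring R)) using (_^_) public
  open CommutativeSemigroupProperties +-commutativeSemigroup using (interchange)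

  C : A → List A
  C c = c ∷ []

  negP : List A → List A
  negP = map -_

  coeff-addP : ∀ p q i → coeff (addP p q) i ≡ coeff p i + coeff q i
  coeff-addP []      q       i       = sym (+-identityˡ _)
  coeff-addP (a ∷ p) []      i       = sym (+-identityʳ _)
  coeff-addP (a ∷ p) (b ∷ q) zero    = refl
  coeff-addP (a ∷ p) (b ∷ q) (suc i) = coeff-addP p q i

  coeff-scaleP : ∀ c p i → coeff (scaleP c p) i ≡ c * coeff p i
  coeff-scaleP c []      i       = sym (zeroʳ c)
  coeff-scaleP c (a ∷ p) zero    = refl
  coeff-scaleP c (a ∷ p) (suc i) = coeff-scaleP c p i

  coeff-negP : ∀ p i → coeff (negP p) i ≡ - coeff p i
  coeff-negP []      i       = sym -0#≈0#
  coeff-negP (a ∷ p) zero    = refl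
  coeff-negP (a ∷ p) (suc i) = coeff-negP p i

  coeff-C0 : ∀ i → coeff (C 0#) i ≡ 0#
  coeff-C0 zero    = refl
  coeff-C0 (suc i) = refl

  coeff-C*P : ∀ c p i → coeff (mulP (C c) p) i ≡ c * coeff p i
  coeff-C*P c p i = begin
    coeff (addP (scaleP c p) (C 0#)) i     ≡⟨ coeff-addP (scaleP c p) (C 0#) i ⟩
    coeff (scaleP c p) i + coeff (C 0#) i  ≡⟨ cong₂ _+_ (coeff-scaleP c p i) (coeff-C0 i) ⟩
    c * coeff p i + 0#                     ≡⟨ +-identityʳ _ ⟩
    c * coeff p i                          ∎
    where open ≡-Reasoning

  -- A record rather than _≈P_ itself, so that p and q can be inferred from a proof.
  infix 4 _≋_
  record _≋_ (p q : List A) : Set where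
    constructor mk≋
    field coeff-≡ : p ≈P q
  open _≋_ public

  ≋-isEquivalence : IsEquivalence _≋_
  ≋-isEquivalence = record
    { refl  = mk≋ λ _ → refl
    ; sym   = λ p≋q → mk≋ λ i → sym (coeff-≡ p≋q i)
    ; trans = λ p≋q q≋r → mk≋ λ i → trans (coeff-≡ p≋q i) (coeff-≡ q≋r i)
    }

  ≋-setoid : Setoid 0ℓ 0ℓ
  ≋-setoid = record { isEquivalence = ≋-isEquivalence }

  open IsEquivalence ≋-isEquivalence public
    using () renaming (refl to ≋-refl; sym to ≋-sym; trans to ≋-trans)

  module ≋-Reasoning = SetoidReasoning ≋-setoid

  ∷-cong : ∀ {a b p q} → a ≡ b → p ≋ q → a ∷ p ≋ b ∷ q
  ∷-cong a≡b p≋q = mk≋ λ { zero → a≡b ; (suc i) → coeff-≡ p≋q i }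

  C0≋[] : C 0# ≋ []
  C0≋[] = mk≋ coeff-C0

  addP-cong : ∀ {p p′ q q′} → p ≋ p′ → q ≋ q′ → addP p q ≋ addP p′ q′
  addP-cong {p} {p′} {q} {q′} p≋p′ q≋q′ = mk≋ λ i → begin
    coeff (addP p q) i      ≡⟨ coeff-addP p q i ⟩
    coeff p i + coeff q i   ≡⟨ cong₂ _+_ (coeff-≡ p≋p′ i) (coeff-≡ q≋q′ i) ⟩
    coeff p′ i + coeff q′ i ≡⟨ coeff-addP p′ q′ i ⟨
    coeff (addP p′ q′) i    ∎
    where open ≡-Reasoning

  addP-congˡ : ∀ p {q q′} → q ≋ q′ → addP p q ≋ addP p q′
  addP-congˡ p = addP-cong ≋-refl

  addP-congʳ : ∀ q {p p′} → p ≋ p′ → addP p q ≋ addP p′ q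
  addP-congʳ q p≋p′ = addP-cong p≋p′ ≋-refl

  scaleP-cong : ∀ c {p q} → p ≋ q → scaleP c p ≋ scaleP c q
  scaleP-cong c {p} {q} p≋q = mk≋ λ i → begin
    coeff (scaleP c p) i ≡⟨ coeff-scaleP c p i ⟩
    c * coeff p i        ≡⟨ cong (c *_) (coeff-≡ p≋q i) ⟩
    c * coeff q i        ≡⟨ coeff-scaleP c q i ⟨
    coeff (scaleP c q) i ∎
    where open ≡-Reasoning

  negP-cong : ∀ {p q} → p ≋ q → negP p ≋ negP q
  negP-cong {p} {q} p≋q = mk≋ λ i → begin
    coeff (negP p) i ≡⟨ coeff-negP p i ⟩
    - coeff p i      ≡⟨ cong -_ (coeff-≡ p≋q i) ⟩
    - coeff q i      ≡⟨ coeff-negP q i ⟨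
    coeff (negP q) i ∎
    where open ≡-Reasoning

  addP-assoc : ∀ p q r → addP (addP p q) r ≋ addP p (addP q r)
  addP-assoc p q r = mk≋ λ i → begin
    coeff (addP (addP p q) r) i             ≡⟨ coeff-addP (addP p q) r i ⟩
    coeff (addP p q) i + coeff r i          ≡⟨ cong (_+ coeff r i) (coeff-addP p q i) ⟩
    coeff p i + coeff q i + coeff r i       ≡⟨ +-assoc _ _ _ ⟩
    coeff p i + (coeff q i + coeff r i)     ≡⟨ cong (coeff p i +_) (coeff-addP q r i) ⟨
    coeff p i + coeff (addP q r) i          ≡⟨ coeff-addP p (addP q r) i ⟨
    coeff (addP p (addP q r)) i             ∎
    where open ≡-Reasoning

  addP-comm : ∀ p q → addP p q ≋ addP q p
  addP-comm p q = mk≋ λ i → begin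
    coeff (addP p q) i    ≡⟨ coeff-addP p q i ⟩
    coeff p i + coeff q i ≡⟨ +-comm _ _ ⟩
    coeff q i + coeff p i ≡⟨ coeff-addP q p i ⟨
    coeff (addP q p) i    ∎
    where open ≡-Reasoning

  addP-identityʳ : ∀ p → addP p [] ≋ p
  addP-identityʳ p = mk≋ λ i → trans (coeff-addP p [] i) (+-identityʳ _)

  addP-inverseˡ : ∀ p → addP (negP p) p ≋ []
  addP-inverseˡ p = mk≋ λ i → begin
    coeff (addP (negP p) p) i    ≡⟨ coeff-addP (negP p) p i ⟩
    coeff (negP p) i + coeff p i ≡⟨ cong (_+ coeff p i) (coeff-negP p i) ⟩
    - coeff p i + coeff p i      ≡⟨ -‿inverseˡ _ ⟩
    0#                           ∎
    where open ≡-Reasoning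

  addP-inverseʳ : ∀ p → addP p (negP p) ≋ []
  addP-inverseʳ p = ≋-trans (addP-comm p (negP p)) (addP-inverseˡ p)

  addP-interchange : ∀ p q r s → addP (addP p q) (addP r s) ≋ addP (addP p r) (addP q s)
  addP-interchange p q r s = mk≋ λ i → begin
    coeff (addP (addP p q) (addP r s)) i
      ≡⟨ trans (coeff-addP (addP p q) _ i) (cong₂ _+_ (coeff-addP p q i) (coeff-addP r s i)) ⟩
    (coeff p i + coeff q i) + (coeff r i + coeff s i)
      ≡⟨ interchange _ _ _ _ ⟩
    (coeff p i + coeff r i) + (coeff q i + coeff s i)
      ≡⟨ trans (coeff-addP (addP p r) _ i) (cong₂ _+_ (coeff-addP p r i) (coeff-addP q s i)) ⟨
    coeff (addP (addP p r) (addP q s)) i ∎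
    where open ≡-Reasoning

  scaleP-distrib : ∀ c p q → scaleP c (addP p q) ≋ addP (scaleP c p) (scaleP c q)
  scaleP-distrib c p q = mk≋ λ i → begin
    coeff (scaleP c (addP p q)) i
      ≡⟨ trans (coeff-scaleP c (addP p q) i) (cong (c *_) (coeff-addP p q i)) ⟩
    c * (coeff p i + coeff q i)
      ≡⟨ distribˡ c _ _ ⟩
    c * coeff p i + c * coeff q i
      ≡⟨ trans (coeff-addP (scaleP c p) _ i) (cong₂ _+_ (coeff-scaleP c p i) (coeff-scaleP c q i)) ⟨
    coeff (addP (scaleP c p) (scaleP c q)) i ∎
    where open ≡-Reasoning

  scaleP-assoc : ∀ c d p → scaleP (c * d) p ≋ scaleP c (scaleP d p)
  scaleP-assoc c d p = mk≋ λ i → begin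
    coeff (scaleP (c * d) p) i  ≡⟨ coeff-scaleP (c * d) p i ⟩
    c * d * coeff p i           ≡⟨ *-assoc c d _ ⟩
    c * (d * coeff p i)         ≡⟨ trans (coeff-scaleP c (scaleP d p) i) (cong (c *_) (coeff-scaleP d p i)) ⟨
    coeff (scaleP c (scaleP d p)) i ∎
    where open ≡-Reasoning

  mulP-shiftˡ : ∀ p q → mulP (0# ∷ p) q ≋ 0# ∷ mulP p q
  mulP-shiftˡ p q = mk≋ λ i → begin
    coeff (addP (scaleP 0# q) (0# ∷ mulP p q)) i
      ≡⟨ coeff-addP (scaleP 0# q) _ i ⟩
    coeff (scaleP 0# q) i + coeff (0# ∷ mulP p q) i
      ≡⟨ cong (_+ coeff (0# ∷ mulP p q) i) (trans (coeff-scaleP 0# q i) (zeroˡ _)) ⟩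
    0# + coeff (0# ∷ mulP p q) i
      ≡⟨ +-identityˡ _ ⟩
    coeff (0# ∷ mulP p q) i ∎
    where open ≡-Reasoning

  mulP-zeroʳ : ∀ p → mulP p [] ≋ []
  mulP-zeroʳ []      = ≋-refl
  mulP-zeroʳ (a ∷ p) = ≋-trans (∷-cong refl (mulP-zeroʳ p)) C0≋[]

  mulP-consʳ : ∀ p a q → mulP p (a ∷ q) ≋ addP (scaleP a p) (0# ∷ mulP p q)
  mulP-consʳ []      a q = ≋-sym C0≋[]
  mulP-consʳ (b ∷ p) a q = ∷-cong (cong (_+ 0#) (*-comm b a)) (begin
    addP (scaleP b q) (mulP p (a ∷ q))
      ≈⟨ addP-congˡ (scaleP b q) (mulP-consʳ p a q) ⟩
    addP (scaleP b q) (addP (scaleP a p) (0# ∷ mulP p q))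
      ≈⟨ addP-assoc (scaleP b q) (scaleP a p) (0# ∷ mulP p q) ⟨
    addP (addP (scaleP b q) (scaleP a p)) (0# ∷ mulP p q)
      ≈⟨ addP-congʳ (0# ∷ mulP p q) (addP-comm (scaleP b q) (scaleP a p)) ⟩
    addP (addP (scaleP a p) (scaleP b q)) (0# ∷ mulP p q)
      ≈⟨ addP-assoc (scaleP a p) (scaleP b q) (0# ∷ mulP p q) ⟩
    addP (scaleP a p) (addP (scaleP b q) (0# ∷ mulP p q)) ∎)
    where open ≋-Reasoning

  mulP-comm : ∀ p q → mulP p q ≋ mulP q p
  mulP-comm []      q = ≋-sym (mulP-zeroʳ q)
  mulP-comm (a ∷ p) q =
    ≋-trans (addP-congˡ (scaleP a q) (∷-cong refl (mulP-comm p q))) (≋-sym (mulP-consʳ q a p))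

  mulP-congˡ : ∀ p {q q′} → q ≋ q′ → mulP p q ≋ mulP p q′
  mulP-congˡ []      q≋q′ = ≋-refl
  mulP-congˡ (a ∷ p) q≋q′ = addP-cong (scaleP-cong a q≋q′) (∷-cong refl (mulP-congˡ p q≋q′))

  mulP-congʳ : ∀ q {p p′} → p ≋ p′ → mulP p q ≋ mulP p′ q
  mulP-congʳ q {p} {p′} p≋p′ = begin
    mulP p q  ≈⟨ mulP-comm p q ⟩
    mulP q p  ≈⟨ mulP-congˡ q p≋p′ ⟩
    mulP q p′ ≈⟨ mulP-comm q p′ ⟩
    mulP p′ q ∎
    where open ≋-Reasoning

  mulP-cong : ∀ {p p′ q q′} → p ≋ p′ → q ≋ q′ → mulP p q ≋ mulP p′ q′
  mulP-cong {p} {p′} {q} {q′} p≋p′ q≋q′ = ≋-trans (mulP-congˡ p q≋q′) (mulP-congʳ q′ p≋p′)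

  mulP-distribˡ : ∀ p q r → mulP p (addP q r) ≋ addP (mulP p q) (mulP p r)
  mulP-distribˡ []      q r = ≋-refl
  mulP-distribˡ (a ∷ p) q r = begin
    addP (scaleP a (addP q r)) (0# ∷ mulP p (addP q r))
      ≈⟨ addP-cong (scaleP-distrib a q r) (∷-cong (sym (+-identityˡ 0#)) (mulP-distribˡ p q r)) ⟩
    addP (addP (scaleP a q) (scaleP a r)) (addP (0# ∷ mulP p q) (0# ∷ mulP p r))
      ≈⟨ addP-interchange (scaleP a q) (scaleP a r) (0# ∷ mulP p q) (0# ∷ mulP p r) ⟩
    addP (mulP (a ∷ p) q) (mulP (a ∷ p) r) ∎
    where open ≋-Reasoning

  mulP-distribʳ : ∀ r p q → mulP (addP p q) r ≋ addP (mulP p r) (mulP q r)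
  mulP-distribʳ r p q = begin
    mulP (addP p q) r          ≈⟨ mulP-comm (addP p q) r ⟩
    mulP r (addP p q)          ≈⟨ mulP-distribˡ r p q ⟩
    addP (mulP r p) (mulP r q) ≈⟨ addP-cong (mulP-comm r p) (mulP-comm r q) ⟩
    addP (mulP p r) (mulP q r) ∎
    where open ≋-Reasoning

  mulP-scaleˡ : ∀ c p q → mulP (scaleP c p) q ≋ scaleP c (mulP p q)
  mulP-scaleˡ c []      q = ≋-refl
  mulP-scaleˡ c (a ∷ p) q = begin
    addP (scaleP (c * a) q) (0# ∷ mulP (scaleP c p) q)
      ≈⟨ addP-cong (scaleP-assoc c a q) (∷-cong (sym (zeroʳ c)) (mulP-scaleˡ c p q)) ⟩
    addP (scaleP c (scaleP a q)) (scaleP c (0# ∷ mulP p q))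
      ≈⟨ scaleP-distrib c (scaleP a q) (0# ∷ mulP p q) ⟨
    scaleP c (mulP (a ∷ p) q) ∎
    where open ≋-Reasoning

  mulP-assoc : ∀ p q r → mulP (mulP p q) r ≋ mulP p (mulP q r)
  mulP-assoc []      q r = ≋-refl
  mulP-assoc (a ∷ p) q r = begin
    mulP (addP (scaleP a q) (0# ∷ mulP p q)) r
      ≈⟨ mulP-distribʳ r (scaleP a q) (0# ∷ mulP p q) ⟩
    addP (mulP (scaleP a q) r) (mulP (0# ∷ mulP p q) r)
      ≈⟨ addP-cong (mulP-scaleˡ a q r) (mulP-shiftˡ (mulP p q) r) ⟩
    addP (scaleP a (mulP q r)) (0# ∷ mulP (mulP p q) r)
      ≈⟨ addP-congˡ (scaleP a (mulP q r)) (∷-cong refl (mulP-assoc p q r)) ⟩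
    mulP (a ∷ p) (mulP q r) ∎
    where open ≋-Reasoning

  mulP-identityˡ : ∀ p → mulP (C 1#) p ≋ p
  mulP-identityˡ p = mk≋ λ i → trans (coeff-C*P 1# p i) (*-identityˡ _)

  mulP-identityʳ : ∀ p → mulP p (C 1#) ≋ p
  mulP-identityʳ p = ≋-trans (mulP-comm p (C 1#)) (mulP-identityˡ p)

  isCommutativeRingP : IsCommutativeRing _≋_ addP mulP negP [] (C 1#)
  isCommutativeRingP = record
    { isRing = record
      { +-isAbelianGroup = record
        { isGroup = record
          { isMonoid = record
            { isSemigroup = record
              { isMagma = record { isEquivalence = ≋-isEquivalence ; ∙-cong = addP-cong }
              ; assoc = addP-assoc }
            ; identity = (λ _ → ≋-refl) , addP-identityʳ }
          ; inverse = addP-inverseˡ , addP-inverseʳ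
          ; ⁻¹-cong = negP-cong }
        ; comm = addP-comm }
      ; *-cong = mulP-cong
      ; *-assoc = mulP-assoc
      ; *-identity = mulP-identityˡ , mulP-identityʳ
      ; distrib = mulP-distribˡ , mulP-distribʳ }
    ; *-comm = mulP-comm }

  commutativeRingP : CommutativeRing 0ℓ 0ℓ
  commutativeRingP = record { isCommutativeRing = isCommutativeRingP }

  open RingProperties (CommutativeRing.ring commutativeRingP)
    using (-‿distribˡ-*; x∙y⁻¹≈ε⇒x≈y; //-rightDividesˡ)
    renaming (+-cancelˡ to addP-cancelˡ; +-cancelʳ to addP-cancelʳ)
  open SemiringSolver (CommutativeRing.commutativeSemiring commutativeRingP)
    using (solve; _:=_; _:+_; _:*_)

  C-* : ∀ a b → C (a * b) ≋ mulP (C a) (C b)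
  C-* a b = mk≋ λ where
    zero    → sym (coeff-C*P a (C b) zero)
    (suc i) → sym (trans (coeff-C*P a (C b) (suc i)) (zeroʳ a))

  mulP-C-∷ : ∀ c a p → mulP (C c) (a ∷ p) ≋ c * a ∷ mulP (C c) p
  mulP-C-∷ c a p = mk≋ λ where
    zero    → coeff-C*P c (a ∷ p) zero
    (suc i) → trans (coeff-C*P c (a ∷ p) (suc i)) (sym (coeff-C*P c p i))

  DegLt-∷ : ∀ {a p n} → DegLt p n → DegLt (a ∷ p) (suc n)
  DegLt-∷ p<n (suc m) (s≤s n≤m) = p<n m n≤m

  DegLt-C*P : ∀ c {p n} → DegLt p n → DegLt (mulP (C c) p) n
  DegLt-C*P c {p} p<n m n≤m = trans (coeff-C*P c p m) (trans (cong (c *_) (p<n m n≤m)) (zeroʳ c))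

  DegLt-length : ∀ p → DegLt p (length p)
  DegLt-length []      m       _         = refl
  DegLt-length (a ∷ p) (suc m) (s≤s le) = DegLt-length p m le

  DegLt-pred : ∀ {p n} → DegLt p (suc n) → coeff p n ≡ 0# → DegLt p n
  DegLt-pred p<1+n pₙ≡0 m n≤m with ℕP.m≤n⇒m<n∨m≡n n≤m
  ... | inj₁ n<m  = p<1+n m n<m
  ... | inj₂ refl = pₙ≡0

  DegLt-0⇒≋[] : ∀ {p} → DegLt p 0 → p ≋ []
  DegLt-0⇒≋[] p<0 = mk≋ λ m → p<0 m z≤n

  module _ {g : List A} {n : ℕ} (g<1+n : DegLt g (suc n)) where

    reduce-top : ∀ s → DegLt s (suc n) →
                 ∃ λ r → DegLt r n × mulP (C (coeff g n)) s ≋ addP r (mulP (C (coeff s n)) g)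
    reduce-top s s<1+n = r , r<n , ≋-sym (//-rightDividesˡ (mulP (C b) g) (mulP (C L) s))
      where
      L = coeff g n
      b = coeff s n
      r = addP (mulP (C L) s) (negP (mulP (C b) g))
      tops-agree : ∀ m → n ≤ m → L * coeff s m ≡ b * coeff g m
      tops-agree m n≤m with ℕP.m≤n⇒m<n∨m≡n n≤m
      ... | inj₁ n<m  = begin
        L * coeff s m  ≡⟨ cong (L *_) (s<1+n m n<m) ⟩
        L * 0#         ≡⟨ zeroʳ L ⟩
        0#             ≡⟨ zeroʳ b ⟨
        b * 0#         ≡⟨ cong (b *_) (g<1+n m n<m) ⟨
        b * coeff g m  ∎
        where open ≡-Reasoning
      ... | inj₂ refl = *-comm L b
      r<n : DegLt r n
      r<n m n≤m = begin
        coeff r m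
          ≡⟨ coeff-addP (mulP (C L) s) _ m ⟩
        coeff (mulP (C L) s) m + coeff (negP (mulP (C b) g)) m
          ≡⟨ cong₂ _+_ (coeff-C*P L s m) (trans (coeff-negP (mulP (C b) g) m) (cong -_ (coeff-C*P b g m))) ⟩
        L * coeff s m + - (b * coeff g m)
          ≡⟨ cong (λ x → x + - (b * coeff g m)) (tops-agree m n≤m) ⟩
        b * coeff g m + - (b * coeff g m)
          ≡⟨ -‿inverseʳ _ ⟩
        0# ∎
        where open ≡-Reasoning

    -- Horner's scheme: from Lᵉ p = r + q g we get Lᵉ (a ∷ p) = (Lᵉ a ∷ r) + (0 ∷ q) g,
    -- and reduce-top brings Lᵉ a ∷ r, of degree at most n, below degree n.
    pseudo-division : ∀ p → ∃ λ e → ∃ λ q → ∃ λ r →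
                      DegLt r n × mulP (C (coeff g n ^ e)) p ≋ addP r (mulP q g)
    pseudo-division []      = 0 , [] , [] , (λ _ _ → refl) , mulP-zeroʳ (C 1#)
    pseudo-division (a ∷ p) with pseudo-division p
    ... | e , q , r , r<n , Lᵉp≋r+qg with reduce-top (coeff g n ^ e * a ∷ r) (DegLt-∷ r<n)
    ... | r′ , r′<n , Ls≋r′+bg = suc e , addP (C b) (mulP (C L) (0# ∷ q)) , r′ , r′<n , (begin
      mulP (C (L * L ^ e)) (a ∷ p)           ≈⟨ mulP-congʳ (a ∷ p) (C-* L (L ^ e)) ⟩
      mulP (mulP (C L) (C (L ^ e))) (a ∷ p)  ≈⟨ mulP-assoc (C L) (C (L ^ e)) (a ∷ p) ⟩
      mulP (C L) (mulP (C (L ^ e)) (a ∷ p))  ≈⟨ mulP-congˡ (C L) Lᵉ[a∷p]≋s+[0∷q]g ⟩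
      mulP (C L) (addP s (mulP (0# ∷ q) g))
        ≈⟨ solve 4 (λ L s q g → L :* (s :+ q :* g) := L :* s :+ (L :* q) :* g) ≋-refl (C L) s (0# ∷ q) g ⟩
      addP (mulP (C L) s) (mulP (mulP (C L) (0# ∷ q)) g)
        ≈⟨ addP-congʳ (mulP (mulP (C L) (0# ∷ q)) g) Ls≋r′+bg ⟩
      addP (addP r′ (mulP (C b) g)) (mulP (mulP (C L) (0# ∷ q)) g)
        ≈⟨ solve 4 (λ r b Lq g → (r :+ b :* g) :+ Lq :* g := r :+ (b :+ Lq) :* g)
                   ≋-refl r′ (C b) (mulP (C L) (0# ∷ q)) g ⟩
      addP r′ (mulP (addP (C b) (mulP (C L) (0# ∷ q))) g) ∎)
      where
      open ≋-Reasoning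
      L = coeff g n
      s = L ^ e * a ∷ r
      b = coeff s n
      Lᵉ[a∷p]≋s+[0∷q]g : mulP (C (L ^ e)) (a ∷ p) ≋ addP s (mulP (0# ∷ q) g)
      Lᵉ[a∷p]≋s+[0∷q]g = begin
        mulP (C (L ^ e)) (a ∷ p)              ≈⟨ mulP-C-∷ (L ^ e) a p ⟩
        L ^ e * a ∷ mulP (C (L ^ e)) p        ≈⟨ ∷-cong (sym (+-identityʳ _)) Lᵉp≋r+qg ⟩
        addP s (0# ∷ mulP q g)                ≈⟨ addP-congˡ s (mulP-shiftˡ q g) ⟨
        addP s (mulP (0# ∷ q) g)              ∎

    reduce-combination : ∀ {f p q c} → addP (mulP p f) (mulP q g) ≋ C c →
                         ∃ λ e → ∃ λ r → ∃ λ q′ →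
                         DegLt r n × addP (mulP r f) (mulP q′ g) ≋ C (coeff g n ^ e * c)
    reduce-combination {f} {p} {q} {c} pf+qg≋c with pseudo-division p
    ... | e , m , r , r<n , Lᵉp≋r+mg = e , r , addP (mulP m f) (mulP (C Lᵉ) q) , r<n , (begin
      addP (mulP r f) (mulP (addP (mulP m f) (mulP (C Lᵉ) q)) g)
        ≈⟨ solve 6 (λ r m f Lᵉ q g → r :* f :+ (m :* f :+ Lᵉ :* q) :* g := (r :+ m :* g) :* f :+ Lᵉ :* q :* g)
                   ≋-refl r m f (C Lᵉ) q g ⟩
      addP (mulP (addP r (mulP m g)) f) (mulP (mulP (C Lᵉ) q) g)
        ≈⟨ addP-congʳ (mulP (mulP (C Lᵉ) q) g) (mulP-congʳ f Lᵉp≋r+mg) ⟨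
      addP (mulP (mulP (C Lᵉ) p) f) (mulP (mulP (C Lᵉ) q) g)
        ≈⟨ solve 5 (λ Lᵉ p f q g → Lᵉ :* p :* f :+ Lᵉ :* q :* g := Lᵉ :* (p :* f :+ q :* g))
                   ≋-refl (C Lᵉ) p f q g ⟩
      mulP (C Lᵉ) (addP (mulP p f) (mulP q g))  ≈⟨ mulP-congˡ (C Lᵉ) pf+qg≋c ⟩
      mulP (C Lᵉ) (C c)                         ≈⟨ C-* Lᵉ c ⟨
      C (Lᵉ * c)                                ∎)
      where
      open ≋-Reasoning
      Lᵉ = coeff g n ^ e

  bezout-scaled : ∀ c {f g p q} → addP (mulP p f) (mulP q g) ≋ C 1# →
                  addP (mulP (mulP (C c) p) f) (mulP (mulP (C c) q) g) ≋ C c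
  bezout-scaled c {f} {g} {p} {q} pf+qg≋1 = begin
    addP (mulP (mulP (C c) p) f) (mulP (mulP (C c) q) g)
      ≈⟨ solve 5 (λ c p f q g → c :* p :* f :+ c :* q :* g := c :* (p :* f :+ q :* g))
                 ≋-refl (C c) p f q g ⟩
    mulP (C c) (addP (mulP p f) (mulP q g)) ≈⟨ mulP-congˡ (C c) pf+qg≋1 ⟩
    mulP (C c) (C 1#)                       ≈⟨ mulP-identityʳ (C c) ⟩
    C c                                     ∎
    where open ≋-Reasoning

  coeff-mulP-top : ∀ {g n} → DegLt g (suc n) → ∀ w j → DegLt w (suc j) →
                   coeff (mulP w g) (j ℕ.+ n) ≡ coeff w j * coeff g n
  coeff-mulP-top {g} {n} g<1+n []      j       _       = sym (zeroˡ _)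
  coeff-mulP-top {g} {n} g<1+n (a ∷ w) zero    a∷w<1 = begin
    coeff (addP (scaleP a g) (0# ∷ mulP w g)) n       ≡⟨ coeff-addP (scaleP a g) _ n ⟩
    coeff (scaleP a g) n + coeff (0# ∷ mulP w g) n   ≡⟨ cong₂ _+_ (coeff-scaleP a g n) (coeff-≡ 0∷wg≋[] n) ⟩
    a * coeff g n + 0#                               ≡⟨ +-identityʳ _ ⟩
    a * coeff g n                                    ∎
    where
    open ≡-Reasoning
    w≋[] : w ≋ []
    w≋[] = DegLt-0⇒≋[] λ m _ → a∷w<1 (suc m) (s≤s z≤n)
    0∷wg≋[] : 0# ∷ mulP w g ≋ []
    0∷wg≋[] = ≋-trans (∷-cong refl (mulP-congʳ g w≋[])) C0≋[]
  coeff-mulP-top {g} {n} g<1+n (a ∷ w) (suc j) a∷w<2+j = begin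
    coeff (addP (scaleP a g) (0# ∷ mulP w g)) (suc j ℕ.+ n)
      ≡⟨ coeff-addP (scaleP a g) _ (suc j ℕ.+ n) ⟩
    coeff (scaleP a g) (suc j ℕ.+ n) + coeff (mulP w g) (j ℕ.+ n)
      ≡⟨ cong₂ _+_ (coeff-scaleP a g (suc j ℕ.+ n))
                   (coeff-mulP-top g<1+n w j (λ m j≤m → a∷w<2+j (suc m) (s≤s j≤m))) ⟩
    a * coeff g (suc j ℕ.+ n) + coeff w j * coeff g n
      ≡⟨ cong (λ x → a * x + coeff w j * coeff g n) (g<1+n (suc j ℕ.+ n) (s≤s (ℕP.m≤n+m n j))) ⟩
    a * 0# + coeff w j * coeff g n
      ≡⟨ trans (cong (_+ coeff w j * coeff g n) (zeroʳ a)) (+-identityˡ _) ⟩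
    coeff w j * coeff g n ∎
    where open ≡-Reasoning

  module WithoutZeroDivisors (x*y≡0⇒x≡0 : ∀ {x y} → y ≢ 0# → x * y ≡ 0# → x ≡ 0#) where

    deg[w*g]<n⇒w≋0 : ∀ {g n} → HasDegree g n → ∀ w → DegLt (mulP w g) n → w ≋ []
    deg[w*g]<n⇒w≋0 {g} {n} (gₙ≢0 , g<1+n) w wg<n =
      DegLt-0⇒≋[] (descend (length w) (DegLt-length w))
      where
      descend : ∀ t → DegLt w t → DegLt w 0
      descend zero    w<0   = w<0
      descend (suc j) w<1+j = descend j (DegLt-pred {w} w<1+j wⱼ≡0)
        where
        wⱼ≡0 : coeff w j ≡ 0#
        wⱼ≡0 = x*y≡0⇒x≡0 gₙ≢0
          (trans (sym (coeff-mulP-top g<1+n w j w<1+j)) (wg<n (j ℕ.+ n) (ℕP.m≤n+m n j)))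

    division-unique : ∀ {g n a b x y} → HasDegree g n → DegLt a n → DegLt b n →
                      addP a (mulP x g) ≋ addP b (mulP y g) → a ≋ b × x ≋ y
    division-unique {g} {n} {a} {b} {x} {y} deg[g]≡n a<n b<n a+xg≋b+yg = a≋b , x≋y
      where
      xgₘ≡ygₘ : ∀ m → n ≤ m → coeff (mulP x g) m ≡ coeff (mulP y g) m
      xgₘ≡ygₘ m n≤m = begin
        coeff (mulP x g) m              ≡⟨ +-identityˡ _ ⟨
        0# + coeff (mulP x g) m         ≡⟨ cong (_+ _) (a<n m n≤m) ⟨
        coeff a m + coeff (mulP x g) m  ≡⟨ coeff-addP a (mulP x g) m ⟨
        coeff (addP a (mulP x g)) m     ≡⟨ coeff-≡ a+xg≋b+yg m ⟩
        coeff (addP b (mulP y g)) m     ≡⟨ coeff-addP b (mulP y g) m ⟩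
        coeff b m + coeff (mulP y g) m  ≡⟨ cong (_+ _) (b<n m n≤m) ⟩
        0# + coeff (mulP y g) m         ≡⟨ +-identityˡ _ ⟩
        coeff (mulP y g) m              ∎
        where open ≡-Reasoning
      [x-y]g≋xg-yg : mulP (addP x (negP y)) g ≋ addP (mulP x g) (negP (mulP y g))
      [x-y]g≋xg-yg =
        ≋-trans (mulP-distribʳ g x (negP y)) (addP-congˡ (mulP x g) (≋-sym (-‿distribˡ-* y g)))
      [x-y]g<n : DegLt (mulP (addP x (negP y)) g) n
      [x-y]g<n m n≤m = begin
        coeff (mulP (addP x (negP y)) g) m
          ≡⟨ coeff-≡ [x-y]g≋xg-yg m ⟩
        coeff (addP (mulP x g) (negP (mulP y g))) m
          ≡⟨ coeff-addP (mulP x g) _ m ⟩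
        coeff (mulP x g) m + coeff (negP (mulP y g)) m
          ≡⟨ cong (coeff (mulP x g) m +_) (coeff-negP (mulP y g) m) ⟩
        coeff (mulP x g) m + - coeff (mulP y g) m
          ≡⟨ cong (λ z → z + - coeff (mulP y g) m) (xgₘ≡ygₘ m n≤m) ⟩
        coeff (mulP y g) m + - coeff (mulP y g) m
          ≡⟨ -‿inverseʳ _ ⟩
        0# ∎
        where open ≡-Reasoning
      x≋y : x ≋ y
      x≋y = x∙y⁻¹≈ε⇒x≈y x y (deg[w*g]<n⇒w≋0 deg[g]≡n (addP x (negP y)) [x-y]g<n)
      a≋b : a ≋ b
      a≋b = addP-cancelʳ (mulP x g) a b
              (≋-trans a+xg≋b+yg (addP-congˡ b (mulP-congʳ g (≋-sym x≋y))))

    bezout-unique : ∀ {f g n p q a a′ b b′} → HasDegree g n →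
                    addP (mulP p f) (mulP q g) ≋ C 1# → DegLt a n → DegLt b n →
                    addP (mulP a f) (mulP a′ g) ≋ addP (mulP b f) (mulP b′ g) → a ≋ b × a′ ≋ b′
    bezout-unique {f} {g} {n} {p} {q} {a} {a′} {b} {b′} deg[g]≡n pf+qg≋1 a<n b<n af+a′g≋bf+b′g =
      a≋b , a′≋b′
      where
      a+[pa′+bq]g≋b+[pb′+aq]g : addP a (mulP (addP (mulP p a′) (mulP b q)) g)
                              ≋ addP b (mulP (addP (mulP p b′) (mulP a q)) g)
      a+[pa′+bq]g≋b+[pb′+aq]g = begin
        addP a (mulP (addP (mulP p a′) (mulP b q)) g)
          ≈⟨ addP-congʳ _ (≋-trans (mulP-congˡ a pf+qg≋1) (mulP-identityʳ a)) ⟨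
        addP (mulP a (addP (mulP p f) (mulP q g))) (mulP (addP (mulP p a′) (mulP b q)) g)
          ≈⟨ solve 7 (λ a a′ b p q f g → a :* (p :* f :+ q :* g) :+ (p :* a′ :+ b :* q) :* g
                                         := p :* (a :* f :+ a′ :* g) :+ (a :+ b) :* q :* g)
                     ≋-refl a a′ b p q f g ⟩
        addP (mulP p (addP (mulP a f) (mulP a′ g))) (mulP (mulP (addP a b) q) g)
          ≈⟨ addP-congʳ _ (mulP-congˡ p af+a′g≋bf+b′g) ⟩
        addP (mulP p (addP (mulP b f) (mulP b′ g))) (mulP (mulP (addP a b) q) g)
          ≈⟨ solve 7 (λ a b b′ p q f g → p :* (b :* f :+ b′ :* g) :+ (a :+ b) :* q :* g
                                         := b :* (p :* f :+ q :* g) :+ (p :* b′ :+ a :* q) :* g)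
                     ≋-refl a b b′ p q f g ⟩
        addP (mulP b (addP (mulP p f) (mulP q g))) (mulP (addP (mulP p b′) (mulP a q)) g)
          ≈⟨ addP-congʳ _ (≋-trans (mulP-congˡ b pf+qg≋1) (mulP-identityʳ b)) ⟩
        addP b (mulP (addP (mulP p b′) (mulP a q)) g) ∎
        where open ≋-Reasoning
      a≋b : a ≋ b
      a≋b = proj₁ (division-unique {g} {x = addP (mulP p a′) (mulP b q)} {y = addP (mulP p b′) (mulP a q)}
                                   deg[g]≡n a<n b<n a+[pa′+bq]g≋b+[pb′+aq]g)
      a′g≋b′g : mulP a′ g ≋ mulP b′ g
      a′g≋b′g = addP-cancelˡ (mulP a f) (mulP a′ g) (mulP b′ g)
        (≋-trans af+a′g≋bf+b′g (addP-congʳ (mulP b′ g) (mulP-congʳ f (≋-sym a≋b))))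
      a′≋b′ : a′ ≋ b′
      a′≋b′ = proj₂ (division-unique {g} {a = []} {b = []} {a′} {b′}
                                     deg[g]≡n (λ _ _ → refl) (λ _ _ → refl) a′g≋b′g)

open import Data.Nat using (_+_; _*_; _^_)

gcd*-greatest : ∀ {x a b z} → x ∣ a * z → x ∣ b * z → x ∣ gcd a b * z
gcd*-greatest {x} {a} {b} {z} x∣az x∣bz = subst (x ∣_) gcd[az,bz]≡gcd[a,b]z (gcd-greatest x∣az x∣bz)
  where
  gcd[az,bz]≡gcd[a,b]z : gcd (a * z) (b * z) ≡ gcd a b * z
  gcd[az,bz]≡gcd[a,b]z = begin
    gcd (a * z) (b * z) ≡⟨ cong₂ gcd (ℕP.*-comm a z) (ℕP.*-comm b z) ⟩
    gcd (z * a) (z * b) ≡⟨ c*gcd[m,n]≡gcd[cm,cn] z a b ⟨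
    z * gcd a b         ≡⟨ ℕP.*-comm z (gcd a b) ⟩
    gcd a b * z         ∎
    where open ≡-Reasoning

gcd^*-greatest : ∀ {x a b} i j {y} → x ∣ a ^ i * y → x ∣ b ^ j * y → x ∣ gcd a b ^ (i + j) * y
gcd^*-greatest {x} {a} {b} zero    j       {y} x∣1*y _     =
  ∣n⇒∣m*n (gcd a b ^ j) (subst (x ∣_) (ℕP.*-identityˡ y) x∣1*y)
gcd^*-greatest {x} {a} {b} (suc i) zero    {y} _     x∣1*y =
  ∣n⇒∣m*n (gcd a b ^ (suc i + 0)) (subst (x ∣_) (ℕP.*-identityˡ y) x∣1*y)
gcd^*-greatest {x} {a} {b} (suc i) (suc j) {y} x∣aⁱ⁺¹y x∣bʲ⁺¹y =
  subst (x ∣_) (sym (ℕP.*-assoc d (d ^ (i + suc j)) y)) (gcd*-greatest {x} {a} {b} {z} x∣a*z x∣b*z)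
  where
  d = gcd a b
  z = d ^ (i + suc j) * y
  swap : ∀ u v w → u * (v * w) ≡ v * (u * w)
  swap u v w = trans (sym (ℕP.*-assoc u v w)) (trans (cong (_* w) (ℕP.*-comm u v)) (ℕP.*-assoc v u w))
  x∣a*z : x ∣ a * z
  x∣a*z = subst (x ∣_) (swap (d ^ (i + suc j)) a y) (gcd^*-greatest {x} {a} {b} i (suc j)
    (subst (x ∣_) (trans (ℕP.*-assoc a (a ^ i) y) (swap a (a ^ i) y)) x∣aⁱ⁺¹y)
    (subst (x ∣_) (swap a (b ^ suc j) y) (∣n⇒∣m*n a x∣bʲ⁺¹y)))
  x∣b*z : x ∣ b * z
  x∣b*z = subst (x ∣_) (trans (cong (λ k → d ^ k * (b * y)) (sym (ℕP.+-suc i j))) (swap (d ^ (i + suc j)) b y))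
    (gcd^*-greatest {x} {a} {b} (suc i) j
      (subst (x ∣_) (swap b (a ^ suc i) y) (∣n⇒∣m*n b x∣aⁱ⁺¹y))
      (subst (x ∣_) (trans (ℕP.*-assoc b (b ^ j) y) (swap b (b ^ j) y)) x∣bʲ⁺¹y))

module ℤ[x] = Polynomials ℤP.+-*-isCommutativeRing
module ℚ[x] = Polynomials ℚP.+-*-isCommutativeRing

toℚᵘ-toℚ : ∀ z → toℚᵘ (toℚ z) ℚᵘ.≃ mkℚᵘ z 0
toℚᵘ-toℚ z = ℚP.toℚᵘ-fromℚᵘ (mkℚᵘ z 0)

toℚ-+ : ∀ a b → toℚ (a ℤ.+ b) ≡ toℚ a ℚ.+ toℚ b
toℚ-+ a b = ℚP.toℚᵘ-injective (begin
  toℚᵘ (toℚ (a ℤ.+ b))            ≈⟨ toℚᵘ-toℚ (a ℤ.+ b) ⟩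
  mkℚᵘ (a ℤ.+ b) 0
    ≈⟨ *≡* (cong (ℤ._* ℤ.1ℤ) (sym (cong₂ ℤ._+_ (ℤP.*-identityʳ a) (ℤP.*-identityʳ b)))) ⟩
  mkℚᵘ a 0 ℚᵘ.+ mkℚᵘ b 0          ≈⟨ ℚᵘP.+-cong (toℚᵘ-toℚ a) (toℚᵘ-toℚ b) ⟨
  toℚᵘ (toℚ a) ℚᵘ.+ toℚᵘ (toℚ b)  ≈⟨ ℚP.toℚᵘ-homo-+ (toℚ a) (toℚ b) ⟨
  toℚᵘ (toℚ a ℚ.+ toℚ b)          ∎)
  where open ℚᵘP.≃-Reasoning

toℚ-* : ∀ a b → toℚ (a ℤ.* b) ≡ toℚ a ℚ.* toℚ b
toℚ-* a b = ℚP.toℚᵘ-injective (begin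
  toℚᵘ (toℚ (a ℤ.* b))            ≈⟨ toℚᵘ-toℚ (a ℤ.* b) ⟩
  mkℚᵘ a 0 ℚᵘ.* mkℚᵘ b 0          ≈⟨ ℚᵘP.*-cong (toℚᵘ-toℚ a) (toℚᵘ-toℚ b) ⟨
  toℚᵘ (toℚ a) ℚᵘ.* toℚᵘ (toℚ b)  ≈⟨ ℚP.toℚᵘ-homo-* (toℚ a) (toℚ b) ⟨
  toℚᵘ (toℚ a ℚ.* toℚ b)          ∎)
  where open ℚᵘP.≃-Reasoning

toℚ-injective : ∀ {a b} → toℚ a ≡ toℚ b → a ≡ b
toℚ-injective {a} {b} toℚa≡toℚb = begin
  a           ≡⟨ ℤP.*-identityʳ a ⟨
  a ℤ.* ℤ.1ℤ  ≡⟨ ℚᵘP.drop-*≡* a≃b ⟩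
  b ℤ.* ℤ.1ℤ  ≡⟨ ℤP.*-identityʳ b ⟩
  b           ∎
  where
  open ≡-Reasoning
  a≃b : mkℚᵘ a 0 ℚᵘ.≃ mkℚᵘ b 0
  a≃b = ℚᵘP.≃-trans (ℚᵘP.≃-sym (toℚᵘ-toℚ a)) (ℚᵘP.≃-trans (ℚP.toℚᵘ-cong toℚa≡toℚb) (toℚᵘ-toℚ b))

toℚP-addP : ∀ p q → toℚP (ℤ[x].addP p q) ≡ ℚ[x].addP (toℚP p) (toℚP q)
toℚP-addP []      q       = refl
toℚP-addP (a ∷ p) []      = refl
toℚP-addP (a ∷ p) (b ∷ q) = cong₂ _∷_ (toℚ-+ a b) (toℚP-addP p q)

toℚP-scaleP : ∀ c p → toℚP (ℤ[x].scaleP c p) ≡ ℚ[x].scaleP (toℚ c) (toℚP p)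
toℚP-scaleP c []      = refl
toℚP-scaleP c (a ∷ p) = cong₂ _∷_ (toℚ-* c a) (toℚP-scaleP c p)

toℚP-mulP : ∀ p q → toℚP (ℤ[x].mulP p q) ≡ ℚ[x].mulP (toℚP p) (toℚP q)
toℚP-mulP []      q = refl
toℚP-mulP (a ∷ p) q = begin
  toℚP (ℤ[x].addP (ℤ[x].scaleP a q) (ℤ.+ 0 ∷ ℤ[x].mulP p q))
    ≡⟨ toℚP-addP (ℤ[x].scaleP a q) _ ⟩
  ℚ[x].addP (toℚP (ℤ[x].scaleP a q)) (toℚ (ℤ.+ 0) ∷ toℚP (ℤ[x].mulP p q))
    ≡⟨ cong₂ ℚ[x].addP (toℚP-scaleP a q) (cong (ℚ.0ℚ ∷_) (toℚP-mulP p q)) ⟩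
  ℚ[x].addP (ℚ[x].scaleP (toℚ a) (toℚP q)) (ℚ.0ℚ ∷ ℚ[x].mulP (toℚP p) (toℚP q)) ∎
  where open ≡-Reasoning

coeff-toℚP : ∀ p i → ℚ[x].coeff (toℚP p) i ≡ toℚ (ℤ[x].coeff p i)
coeff-toℚP []      i       = refl
coeff-toℚP (a ∷ p) zero    = refl
coeff-toℚP (a ∷ p) (suc i) = coeff-toℚP p i

toℚP-cong : ∀ {p q} → p ℤ[x].≋ q → toℚP p ℚ[x].≋ toℚP q
toℚP-cong {p} {q} p≋q = ℚ[x].mk≋ λ i →
  trans (coeff-toℚP p i) (trans (cong toℚ (ℤ[x].coeff-≡ p≋q i)) (sym (coeff-toℚP q i)))

DegLt-toℚP : ∀ {p n} → ℤ[x].DegLt p n → ℚ[x].DegLt (toℚP p) n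
DegLt-toℚP {p} p<n m n≤m = trans (coeff-toℚP p m) (cong toℚ (p<n m n≤m))

HasDegree-toℚP : ∀ {g n} → ℤ[x].HasDegree g n → ℚ[x].HasDegree (toℚP g) n
HasDegree-toℚP {g} {n} (gₙ≢0 , g<1+n) =
  (λ toℚgₙ≡0 → gₙ≢0 (toℚ-injective (trans (sym (coeff-toℚP g n)) toℚgₙ≡0))) , DegLt-toℚP {g} g<1+n

toℚP-bezout : ∀ p f q g → toℚP (ℤ[x].addP (ℤ[x].mulP p f) (ℤ[x].mulP q g))
                          ≡ ℚ[x].addP (ℚ[x].mulP (toℚP p) (toℚP f)) (ℚ[x].mulP (toℚP q) (toℚP g))
toℚP-bezout p f q g = trans (toℚP-addP (ℤ[x].mulP p f) _) (cong₂ ℚ[x].addP (toℚP-mulP p f) (toℚP-mulP q g))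

x*y≡0⇒x≡0 : ∀ {x y} → y ≢ ℚ.0ℚ → x ℚ.* y ≡ ℚ.0ℚ → x ≡ ℚ.0ℚ
x*y≡0⇒x≡0 {x} {y} y≢0 x*y≡0 = begin
  x                      ≡⟨ ℚP.*-identityʳ x ⟨
  x ℚ.* ℚ.1ℚ             ≡⟨ cong (x ℚ.*_) (ℚP.*-inverseʳ y) ⟨
  x ℚ.* (y ℚ.* ℚ.1/ y)   ≡⟨ ℚP.*-assoc x y (ℚ.1/ y) ⟨
  (x ℚ.* y) ℚ.* ℚ.1/ y   ≡⟨ cong (ℚ._* ℚ.1/ y) x*y≡0 ⟩
  ℚ.0ℚ ℚ.* ℚ.1/ y        ≡⟨ ℚP.*-zeroˡ (ℚ.1/ y) ⟩
  ℚ.0ℚ                   ∎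
  where
  open ≡-Reasoning
  instance
    y-nonZero : ℚ.NonZero y
    y-nonZero = ℚ.≢-nonZero y≢0

open ℚ[x].WithoutZeroDivisors x*y≡0⇒x≡0 using (bezout-unique)

*-integral⇒denominator∣ : ∀ N {x} z → toℚ N ℚ.* x ≡ toℚ z → ℚ.denominatorℕ x ∣ ∣ N ∣
*-integral⇒denominator∣ N {x@(mkℚ a d-1 a⊥d)} z Nx≡z =
  Coprime.coprime-divisor (Coprime.sym (Coprime.recompute a⊥d)) (divides ∣ z ∣ (begin
    ∣ a ∣ * ∣ N ∣                 ≡⟨ ℕP.*-comm ∣ a ∣ ∣ N ∣ ⟩
    ∣ N ∣ * ∣ a ∣                 ≡⟨ ℤP.abs-* N a ⟨
    ∣ N ℤ.* a ∣                   ≡⟨ cong ∣_∣ (ℤP.*-identityʳ (N ℤ.* a)) ⟨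
    ∣ N ℤ.* a ℤ.* ℤ.1ℤ ∣          ≡⟨ cong ∣_∣ (ℚᵘP.drop-*≡* Na≃z) ⟩
    ∣ z ℤ.* ℤ.+ suc (d-1 + 0) ∣   ≡⟨ ℤP.abs-* z _ ⟩
    ∣ z ∣ * suc (d-1 + 0)         ≡⟨ cong (λ k → ∣ z ∣ * suc k) (ℕP.+-identityʳ d-1) ⟩
    ∣ z ∣ * suc d-1               ∎))
  where
  open ≡-Reasoning
  Na≃z : mkℚᵘ N 0 ℚᵘ.* mkℚᵘ a d-1 ℚᵘ.≃ mkℚᵘ z 0
  Na≃z = begin-≃
    mkℚᵘ N 0 ℚᵘ.* mkℚᵘ a d-1     ≈⟨ ℚᵘP.*-congʳ (toℚᵘ-toℚ N) ⟨
    toℚᵘ (toℚ N) ℚᵘ.* toℚᵘ x     ≈⟨ ℚP.toℚᵘ-homo-* (toℚ N) x ⟨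
    toℚᵘ (toℚ N ℚ.* x)           ≈⟨ ℚP.toℚᵘ-cong Nx≡z ⟩
    toℚᵘ (toℚ z)                 ≈⟨ toℚᵘ-toℚ z ⟩
    mkℚᵘ z 0                     ∎≃
    where open ℚᵘP.≃-Reasoning renaming (begin_ to begin-≃_; _∎ to _∎≃)

∣i^n*j∣≡∣i∣^n*∣j∣ : ∀ i n j → ∣ i ℤ[x].^ n ℤ.* j ∣ ≡ ∣ i ∣ ^ n * ∣ j ∣
∣i^n*j∣≡∣i∣^n*∣j∣ i n j = trans (ℤP.abs-* (i ℤ[x].^ n) j) (cong (_* ∣ j ∣) (∣i^n∣≡∣i∣^n n))
  where
  ∣i^n∣≡∣i∣^n : ∀ n → ∣ i ℤ[x].^ n ∣ ≡ ∣ i ∣ ^ n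
  ∣i^n∣≡∣i∣^n zero    = refl
  ∣i^n∣≡∣i∣^n (suc n) = trans (ℤP.abs-* i (i ℤ[x].^ n)) (cong (∣ i ∣ *_) (∣i^n∣≡∣i∣^n n))

solution-denominators :
  ∀ {f g n R Q′ p q c} → ℤ[x].HasDegree g n → ℤ[x].DegLt R n →
  ℤ[x].addP (ℤ[x].mulP R f) (ℤ[x].mulP Q′ g) ℤ[x].≋ ℤ[x].C c →
  ℚ[x].addP (ℚ[x].mulP p (toℚP f)) (ℚ[x].mulP q (toℚP g)) ℚ[x].≋ ℚ[x].C ℚ.1ℚ →
  ℚ[x].DegLt p n →
  ∀ i → (ℚ.denominatorℕ (ℚ[x].coeff p i) ∣ ∣ c ∣) × (ℚ.denominatorℕ (ℚ[x].coeff q i) ∣ ∣ c ∣)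
solution-denominators {f} {g} {n} {R} {Q′} {p} {q} {c} deg[g]≡n R<n Rf+Q′g≋c pf+qg≋1 p<n i =
  integral (proj₁ unique) , integral (proj₂ unique)
  where
  unique : toℚP R ℚ[x].≋ ℚ[x].mulP (ℚ[x].C (toℚ c)) p
         × toℚP Q′ ℚ[x].≋ ℚ[x].mulP (ℚ[x].C (toℚ c)) q
  unique = bezout-unique {toℚP f} {toℚP g} {n} {p} {q} {toℚP R} {toℚP Q′}
    (HasDegree-toℚP {g} deg[g]≡n) pf+qg≋1 (DegLt-toℚP {R} {n} R<n) (ℚ[x].DegLt-C*P (toℚ c) {p} p<n)
    (ℚ[x].≋-trans (subst (ℚ[x]._≋ ℚ[x].C (toℚ c)) (toℚP-bezout R f Q′ g) (toℚP-cong Rf+Q′g≋c))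
                  (ℚ[x].≋-sym (ℚ[x].bezout-scaled (toℚ c) {toℚP f} {toℚP g} {p} {q} pf+qg≋1)))
  integral : ∀ {S s} → toℚP S ℚ[x].≋ ℚ[x].mulP (ℚ[x].C (toℚ c)) s →
             ℚ.denominatorℕ (ℚ[x].coeff s i) ∣ ∣ c ∣
  integral {S} {s} S≋cs = *-integral⇒denominator∣ c (ℤ[x].coeff S i) (begin
    toℚ c ℚ.* ℚ[x].coeff s i                      ≡⟨ ℚ[x].coeff-C*P (toℚ c) s i ⟨
    ℚ[x].coeff (ℚ[x].mulP (ℚ[x].C (toℚ c)) s) i   ≡⟨ ℚ[x].coeff-≡ S≋cs i ⟨
    ℚ[x].coeff (toℚP S) i                         ≡⟨ coeff-toℚP S i ⟩
    toℚ (ℤ[x].coeff S i)                          ∎)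
    where open ≡-Reasoning

bezout-denominators :
  ∀ {f g n P Q p q} r → ℤ[x].HasDegree g n →
  ℤ[x].addP (ℤ[x].mulP P f) (ℤ[x].mulP Q g) ℤ[x].≋ ℤ[x].C (ℤ.+ r) →
  ℚ[x].addP (ℚ[x].mulP p (toℚP f)) (ℚ[x].mulP q (toℚP g)) ℚ[x].≋ ℚ[x].C ℚ.1ℚ →
  ℚ[x].DegLt p n →
  ∃ λ e → ∀ i → (ℚ.denominatorℕ (ℚ[x].coeff p i) ∣ ∣ ℤ[x].coeff g n ∣ ^ e * r)
              × (ℚ.denominatorℕ (ℚ[x].coeff q i) ∣ ∣ ℤ[x].coeff g n ∣ ^ e * r)
bezout-denominators {f} {g} {n} {P} {Q} {p} {q} r deg[g]≡n Pf+Qg≋r pf+qg≋1 p<n =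
  let e , R , Q′ , R<n , Rf+Q′g≋Lᵉr = ℤ[x].reduce-combination (proj₂ deg[g]≡n) {f} {P} {Q} Pf+Qg≋r
      ∣Lᵉr∣≡∣L∣ᵉr = ∣i^n*j∣≡∣i∣^n*∣j∣ (ℤ[x].coeff g n) e (ℤ.+ r)
  in e , λ i → Product.map (subst (_ ∣_) ∣Lᵉr∣≡∣L∣ᵉr) (subst (_ ∣_) ∣Lᵉr∣≡∣L∣ᵉr)
                 (solution-denominators {f} {g} {n} {R} {Q′} {p} {q} deg[g]≡n R<n Rf+Q′g≋Lᵉr pf+qg≋1 p<n i)

lcmDenoms-least : ∀ {N} cs → (∀ i → ℚ.denominatorℕ (ℚ[x].coeff cs i) ∣ N) → lcmDenoms cs ∣ N
lcmDenoms-least {N} []       _      = 1∣ N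
lcmDenoms-least     (c ∷ cs) den∣N = lcm-least (den∣N 0) (lcmDenoms-least cs (λ i → den∣N (suc i)))

B-least : ∀ {N} p q → (∀ i → ℚ.denominatorℕ (ℚ[x].coeff p i) ∣ N) →
          (∀ i → ℚ.denominatorℕ (ℚ[x].coeff q i) ∣ N) → B p q ∣ N
B-least []      q _      den[q]∣N = lcmDenoms-least q den[q]∣N
B-least (c ∷ p) q den[p]∣N den[q]∣N =
  lcm-least (den[p]∣N 0) (B-least p q (λ i → den[p]∣N (suc i)) den[q]∣N)

theorem3p1 : (f g : List ℤ) (m n : ℕ) →
    ZP.HasDegree f m → 0 < m →
    ZP.HasDegree g n → 0 < n →
    CoprimeQ f g →
    (p q : List ℚ) → IsBezoutPair f g m n p q →
    (r : ℕ) → IsReducedResultant f g r →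
    ∃ λ k → B p q ∣ gcdLead f g m n ^ k * r
theorem3p1 f g m n deg[f]≡m _ deg[g]≡n _ _ p q (pf+qg≈1 , p<n , q<m) r (_ , (P , Q , Pf+Qg≈r) , _) =
  let e₁ , den∣∣Lg∣ᵉ¹r = bezout-denominators {f} {g} {n} {P} {Q} {p} {q} r deg[g]≡n Pf+Qg≋r pf+qg≋1 p<n
      e₂ , den∣∣Lf∣ᵉ²r = bezout-denominators {g} {f} {m} {Q} {P} {q} {p} r deg[f]≡m Qg+Pf≋r qg+pf≋1 q<m
  in e₂ + e₁ , B-least p q
       (λ i → gcd^*-greatest {b = ∣Lg∣} e₂ e₁ (proj₂ (den∣∣Lf∣ᵉ²r i)) (proj₁ (den∣∣Lg∣ᵉ¹r i)))
       (λ i → gcd^*-greatest {b = ∣Lg∣} e₂ e₁ (proj₁ (den∣∣Lf∣ᵉ²r i)) (proj₂ (den∣∣Lg∣ᵉ¹r i)))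
  where
  ∣Lg∣ : ℕ
  ∣Lg∣ = ∣ ℤ[x].coeff g n ∣
  Pf+Qg≋r : ℤ[x].addP (ℤ[x].mulP P f) (ℤ[x].mulP Q g) ℤ[x].≋ ℤ[x].C (ℤ.+ r)
  Pf+Qg≋r = ℤ[x].mk≋ Pf+Qg≈r
  Qg+Pf≋r : ℤ[x].addP (ℤ[x].mulP Q g) (ℤ[x].mulP P f) ℤ[x].≋ ℤ[x].C (ℤ.+ r)
  Qg+Pf≋r = ℤ[x].≋-trans (ℤ[x].addP-comm (ℤ[x].mulP Q g) (ℤ[x].mulP P f)) Pf+Qg≋r
  pf+qg≋1 : ℚ[x].addP (ℚ[x].mulP p (toℚP f)) (ℚ[x].mulP q (toℚP g)) ℚ[x].≋ ℚ[x].C ℚ.1ℚ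
  pf+qg≋1 = ℚ[x].mk≋ pf+qg≈1
  qg+pf≋1 : ℚ[x].addP (ℚ[x].mulP q (toℚP g)) (ℚ[x].mulP p (toℚP f)) ℚ[x].≋ ℚ[x].C ℚ.1ℚ
  qg+pf≋1 = ℚ[x].≋-trans (ℚ[x].addP-comm (ℚ[x].mulP q (toℚP g)) (ℚ[x].mulP p (toℚP f))) pf+qg≋1
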